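{- Let $X$ be a connected graph without loops and multiple edges. (1) If $X$ is locally finite, then $X$ has infinite diameter if and only if it contains a ray. (2) If $X$ is not locally finite, then $X$ has infinite diameter if and only if it contains a ray with infinite diameter or a star ball.
   Context: $\mathrm{d}_X$ is the graph metric, $\operatorname{diam}$ the diameter, $K(z,n)=\{x\in VX\mid \mathrm{d}_X(x,z)\le n\}$ for $z\in VX$, $n\in\mathbb N$ (a ball). A ray is a sequence $(x_n)_{n\in\mathbb N}$ of pairwise distinct vertices with $x_n$ adjacent to $x_{n+1}$; its diameter is that of its vertex set. For $e\subseteq VX$ let $\mathcal C_0(e)$ be the set of connected components of $VX\setminus e$ having finite diameter. A star ball is a ball $K$ with $\sup\{\operatorname{diam}C\mid C\in\mathcal C_0(K)\}=\infty$. -}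

module Defs where

open import Level using (0ℓ)
open import Data.Nat using (ℕ; zero; suc; _≤_)
open import Data.Product using (Σ; ∃; ∃-syntax; _×_; _,_)
open import Data.Sum using (_⊎_)
open import Data.Unit using (⊤)
open import Data.Empty using (⊥)
open import Data.List using (List)
open import Data.List.Membership.Propositional using (_∈_)
open import Relation.Nullary using (¬_)
open import Relation.Binary.PropositionalEquality using (_≡_)
open import Function.Definitions using (Injective)

-- A simple graph: symmetric, irreflexive (no loops) adjacency relation,
-- proof-irrelevant (no multiple edges).  Vertex set is an arbitrary type.
record Graph : Set₁ where
  field
    V       : Set
    E       : V → V → Set
    E-sym   : ∀ {x y} → E x y → E y x
    E-irrefl : ∀ {x} → ¬ E x x
    E-prop  : ∀ {x y} (p q : E x y) → p ≡ q

module _ (X : Graph) where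
  open Graph X

  data Walk : V → V → ℕ → Set where
    nil  : ∀ {x} → Walk x x zero
    cons : ∀ {x y z n} → E x y → Walk y z n → Walk x z (suc n)

  data WalkIn (P : V → Set) : V → V → Set where
    nil  : ∀ {x} → P x → WalkIn P x x
    cons : ∀ {x y z} → P x → E x y → WalkIn P y z → WalkIn P x z

  Connected : Set
  Connected = ∀ x y → ∃[ n ] Walk x y n

  -- d_X(x,y) ≤ n  (graph metric: length of a shortest walk)
  DistLe : V → V → ℕ → Set
  DistLe x y n = ∃[ m ] (m ≤ n × Walk x y m)

  DiamLe : (V → Set) → ℕ → Set
  DiamLe S n = ∀ x y → S x → S y → DistLe x y n

  FiniteDiam : (V → Set) → Set
  FiniteDiam S = ∃[ n ] DiamLe S n

  InfiniteDiam : Set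
  InfiniteDiam = ¬ FiniteDiam (λ _ → ⊤)

  Ball : V → ℕ → V → Set
  Ball z n x = DistLe x z n

  LocallyFinite : Set
  LocallyFinite = ∀ x → ∃[ L ] (∀ y → E x y → y ∈ L)

  record Ray : Set where
    field
      seq  : ℕ → V
      inj  : Injective _≡_ _≡_ seq
      adj  : ∀ n → E (seq n) (seq (suc n))

  RayVertices : Ray → V → Set
  RayVertices r v = ∃[ i ] Ray.seq r i ≡ v

  -- the connected component of V∖e containing z (z ∉ e)
  Component : (V → Set) → V → V → Set
  Component e z = WalkIn (λ v → ¬ e v) z

  InC₀ : (V → Set) → V → Set
  InC₀ e z = ¬ e z × FiniteDiam (Component e z)

  IsStarBall : (V → Set) → Set
  IsStarBall K = ∀ n → ∃[ z ] (InC₀ K z × ¬ DiamLe (Component K z) n)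

  HasStarBall : Set
  HasStarBall = ∃[ z ] ∃[ n ] IsStarBall (Ball z n)

  HasRay : Set
  HasRay = Ray

  HasInfDiamRay : Set
  HasInfDiamRay = Σ Ray λ r → ¬ FiniteDiam (RayVertices r)

-- Fix a vertex z. If no ball around z is a star ball, the finite-diameter
-- components of V ∖ K(z,n) have diameters bounded by some D n. A point of an
-- infinite-diameter set S at distance > D n + n + 1 from z then lies in a
-- component of V ∖ K(z,n) of infinite diameter, since every component reaches
-- K(z,n+1). Iterating inside these components yields centres c n with walks
-- from c n to c (n+1) avoiding K(z,n); their concatenation is a walk leaving
-- every ball, hence visiting every vertex finitely often, and erasing the
-- loops at last visits turns it into a ray of infinite diameter.
-- In a locally finite graph balls are finite, so a ray cannot stay in one,
-- and the finitely many components meeting K(z,n+1) leave no room for a star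
-- ball.
module Submission where

open import Defs
open import Level using (0ℓ)
open import Axiom.ExcludedMiddle using (ExcludedMiddle)
open import Axiom.DoubleNegationElimination using (em⇒dne)
open import Data.Product using (Σ; ∃; _×_; _,_; proj₁; proj₂)
open import Data.Sum using (_⊎_; inj₁; inj₂)
open import Data.Unit using (tt)
open import Data.Empty using (⊥-elim)
open import Data.Nat using (ℕ; zero; suc; _+_; _∸_; _≤_; _<_; z≤n; s≤s)
open import Data.Nat.Properties
open import Data.List using (List; []; _∷_; concatMap; length; lookup)
open import Data.List.Membership.Propositional using (_∈_; lose)
open import Data.List.Membership.Propositional.Properties using (∈-concatMap⁺)
open import Data.List.Relation.Unary.Any using (here; there; index)
open import Data.List.Relation.Unary.Any.Properties using (lookup-index)
open import Data.Fin using (toℕ)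
open import Data.Fin.Properties using (pigeonhole)
open import Relation.Nullary using (¬_; yes; no)
open import Relation.Binary using (tri<; tri≈; tri>)
open import Relation.Binary.PropositionalEquality
  using (_≡_; _≢_; refl; sym; trans; cong; subst)
open import Function.Bundles using (_⇔_; mk⇔)
open import Function.Definitions using (Injective)

strictMono-step : (f : ℕ → ℕ) → (∀ k → f k < f (suc k)) → ∀ {i j} → i < j → f i < f j
strictMono-step f step {i} {suc j} (s≤s i≤j) with m≤n⇒m<n∨m≡n i≤j
... | inj₁ i<j  = <-trans (strictMono-step f step i<j) (step j)
... | inj₂ refl = step j

strictMono-step⇒≥id : (f : ℕ → ℕ) → (∀ k → f k < f (suc k)) → ∀ k → k ≤ f k
strictMono-step⇒≥id f step zero    = z≤n
strictMono-step⇒≥id f step (suc k) = ≤-trans (s≤s (strictMono-step⇒≥id f step k)) (step k)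

¬injection-into-list : {A : Set} (f : ℕ → A) (L : List A) →
                       Injective _≡_ _≡_ f → ¬ (∀ i → f i ∈ L)
¬injection-into-list f L f-inj f∈L
  with pigeonhole (n<1+n (length L)) (λ k → index (f∈L (toℕ k)))
... | a , b , a<b , same-index = <-irrefl (f-inj f-a≡f-b) a<b
  where
  f-a≡f-b : f (toℕ a) ≡ f (toℕ b)
  f-a≡f-b = trans (lookup-index (f∈L (toℕ a)))
              (trans (cong (lookup L) same-index) (sym (lookup-index (f∈L (toℕ b)))))

module _ (X : Graph) where
  open Graph X

  _++ʷ_ : ∀ {x y z m n} → Walk X x y m → Walk X y z n → Walk X x z (m + n)
  nil      ++ʷ q = q
  cons e p ++ʷ q = cons e (p ++ʷ q)

  walk-snoc : ∀ {x y z n} → Walk X x y n → E y z → Walk X x z (suc n)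
  walk-snoc nil        e = cons e nil
  walk-snoc (cons d p) e = cons d (walk-snoc p e)

  walk-reverse : ∀ {x y n} → Walk X x y n → Walk X y x n
  walk-reverse nil        = nil
  walk-reverse (cons e p) = walk-snoc (walk-reverse p) (E-sym e)

  dist-refl : ∀ {x} n → DistLe X x x n
  dist-refl n = 0 , z≤n , nil

  dist-sym : ∀ {x y n} → DistLe X x y n → DistLe X y x n
  dist-sym (m , m≤n , p) = m , m≤n , walk-reverse p

  dist-trans : ∀ {x y z m n} → DistLe X x y m → DistLe X y z n → DistLe X x z (m + n)
  dist-trans (k , k≤m , p) (l , l≤n , q) = k + l , +-mono-≤ k≤m l≤n , p ++ʷ q

  dist-mono : ∀ {x y m n} → m ≤ n → DistLe X x y m → DistLe X x y n
  dist-mono m≤n (k , k≤m , p) = k , ≤-trans k≤m m≤n , p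

  dist-step : ∀ {x y z n} → E x y → DistLe X y z n → DistLe X x z (suc n)
  dist-step e (m , m≤n , p) = suc m , s≤s m≤n , cons e p

  diam-mono : ∀ {S m n} → m ≤ n → DiamLe X S m → DiamLe X S n
  diam-mono m≤n diam x y x∈S y∈S = dist-mono m≤n (diam x y x∈S y∈S)

  diam-⊆ : ∀ {S T : V → Set} {n} → (∀ x → T x → S x) → DiamLe X S n → DiamLe X T n
  diam-⊆ T⊆S diam x y x∈T y∈T = diam x y (T⊆S x x∈T) (T⊆S y y∈T)

  diam-from-centre : ∀ {S z M} → (∀ x → S x → DistLe X x z M) → DiamLe X S (M + M)
  diam-from-centre near x y x∈S y∈S = dist-trans (near x x∈S) (dist-sym (near y y∈S))

  module _ {P : V → Set} where
    walkIn-++ : ∀ {x y z} → WalkIn X P x y → WalkIn X P y z → WalkIn X P x z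
    walkIn-++ (nil _)        q = q
    walkIn-++ (cons px e p) q = cons px e (walkIn-++ p q)

    walkIn-snoc : ∀ {x y z} → WalkIn X P x y → E y z → P z → WalkIn X P x z
    walkIn-snoc (nil px)       e pz = cons px e (nil pz)
    walkIn-snoc (cons px d p)  e pz = cons px d (walkIn-snoc p e pz)

    walkIn-reverse : ∀ {x y} → WalkIn X P x y → WalkIn X P y x
    walkIn-reverse (nil px)      = nil px
    walkIn-reverse (cons px e p) = walkIn-snoc (walkIn-reverse p) (E-sym e) px

    walkIn-head : ∀ {x y} → WalkIn X P x y → P x
    walkIn-head (nil px)      = px
    walkIn-head (cons px _ _) = px

  component-⊆ : ∀ {K c c′ y} → Component X K c′ y → Component X K c y →
                ∀ x → Component X K c x → Component X K c′ x
  component-⊆ c′~y c~y x c~x = walkIn-++ c′~y (walkIn-++ (walkIn-reverse c~y) c~x)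

  infDiamRay⇒infinite : HasInfDiamRay X → InfiniteDiam X
  infDiamRay⇒infinite (_ , unbounded) (D , diam) = unbounded (D , λ x y _ _ → diam x y tt tt)

  starBall⇒infinite : HasStarBall X → InfiniteDiam X
  starBall⇒infinite (_ , _ , star) (D , diam) with star D
  ... | _ , _ , unbounded = unbounded (λ x y _ _ → diam x y tt tt)

  module Concatenation (P : ℕ → V → Set) (c : ℕ → V)
                       (link : ∀ n → WalkIn X (P n) (c n) (c (suc n))) where

    record Position : Set where
      constructor position
      field
        stage  : ℕ
        vertex : V
        rest   : WalkIn X (P stage) vertex (c (suc stage))
    open Position

    next : Position → Position
    next (position n _ (nil _))      = position (suc n) (c (suc n)) (link (suc n))
    next (position n _ (cons _ _ p)) = position n _ p

    advance : ℕ → Position → Position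
    advance zero    s = s
    advance (suc k) s = advance k (next s)

    advance-+ : ∀ i k s → advance (i + k) s ≡ advance k (advance i s)
    advance-+ zero    k s = refl
    advance-+ (suc i) k s = advance-+ i k (next s)

    advance-suc : ∀ k s → advance (suc k) s ≡ next (advance k s)
    advance-suc zero    s = refl
    advance-suc (suc k) s = advance-suc k (next s)

    stage-next : ∀ s → stage s ≤ stage (next s)
    stage-next (position n _ (nil _))      = n≤1+n n
    stage-next (position n _ (cons _ _ _)) = ≤-refl

    stage-advance : ∀ k s → stage s ≤ stage (advance k s)
    stage-advance zero    s = ≤-refl
    stage-advance (suc k) s = ≤-trans (stage-next s) (stage-advance k (next s))

    stage-progress : ∀ {n v} (p : WalkIn X (P n) v (c (suc n))) →
                     ∃ λ k → suc n ≤ stage (advance k (position n v p))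
    stage-progress (nil _) = 1 , ≤-refl
    stage-progress (cons _ _ p) with stage-progress p
    ... | k , progress = suc k , progress

    vertex-next : ∀ s → vertex (next s) ≡ vertex s ⊎ E (vertex s) (vertex (next s))
    vertex-next (position n _ (nil _))      = inj₁ refl
    vertex-next (position n _ (cons _ e _)) = inj₂ e

    at : ℕ → Position
    at i = advance i (position 0 (c 0) (link 0))

    walk : ℕ → V
    walk i = vertex (at i)

    walk-step : ∀ i → walk (suc i) ≡ walk i ⊎ E (walk i) (walk (suc i))
    walk-step i = subst (λ s → vertex s ≡ walk i ⊎ E (walk i) (vertex s))
                        (sym (advance-suc i _)) (vertex-next (at i))

    walk-in-stage : ∀ i → P (stage (at i)) (walk i)
    walk-in-stage i = walkIn-head (rest (at i))

    stage-mono : ∀ {i j} → i ≤ j → stage (at i) ≤ stage (at j)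
    stage-mono {i} {j} i≤j = begin
      stage (at i)                     ≤⟨ stage-advance (j ∸ i) (at i) ⟩
      stage (advance (j ∸ i) (at i))   ≡⟨ cong stage (sym (advance-+ i (j ∸ i) _)) ⟩
      stage (at (i + (j ∸ i)))         ≡⟨ cong (λ k → stage (at k)) (m+[n∸m]≡n i≤j) ⟩
      stage (at j)                     ∎
      where open ≤-Reasoning

    stage-unbounded : ∀ n → ∃ λ N → n ≤ stage (at N)
    stage-unbounded zero = 0 , z≤n
    stage-unbounded (suc n) with stage-unbounded n
    ... | N , n≤ with stage-progress (rest (at N))
    ... | k , progress = N + k ,
          subst (λ s → suc n ≤ stage s) (sym (advance-+ N k _)) (≤-trans (s≤s n≤) progress)

    stage-eventually : ∀ n → ∃ λ N → ∀ i → N ≤ i → n ≤ stage (at i)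
    stage-eventually n with stage-unbounded n
    ... | N , n≤ = N , λ i N≤i → ≤-trans n≤ (stage-mono N≤i)

  module _ (em : ExcludedMiddle 0ℓ) where

    private
      dne : {A : Set} → ¬ ¬ A → A
      dne = em⇒dne em

    last-index : (P : ℕ → Set) (B : ℕ) → (∀ i → P i → i < B) → ∀ {a} → P a →
                 ∃ λ t → P t × a ≤ t × (∀ i → t < i → ¬ P i)
    last-index P zero    bound pa = ⊥-elim (n≮0 (bound _ pa))
    last-index P (suc B) bound {a} pa with em {P B}
    ... | yes pB = B , pB , ≤-pred (bound a pa) , λ i B<i pi → <⇒≱ B<i (≤-pred (bound i pi))
    ... | no ¬pB = last-index P B (λ i pi → ≤∧≢⇒< (≤-pred (bound i pi)) λ { refl → ¬pB pi }) pa

    module RayExtraction (w : ℕ → V)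
                         (w-step : ∀ i → w (suc i) ≡ w i ⊎ E (w i) (w (suc i)))
                         (finite-visits : ∀ v → ∃ λ B → ∀ i → w i ≡ v → i < B) where

      last-visit : ∀ i → ∃ λ t → w t ≡ w i × i ≤ t × (∀ j → t < j → w j ≢ w i)
      last-visit i = last-index (λ j → w j ≡ w i) (proj₁ (finite-visits (w i)))
                                (proj₂ (finite-visits (w i))) refl

      -- The ray jumps from the last visit of a vertex to the next vertex of the walk.
      start time : ℕ → ℕ
      start zero    = 0
      start (suc k) = suc (time k)
      time k = proj₁ (last-visit (start k))

      time-final : ∀ k j → time k < j → w j ≢ w (time k)
      time-final k j t<j w-j≡ =
        proj₂ (proj₂ (proj₂ (last-visit (start k)))) j t<j
          (trans w-j≡ (proj₁ (proj₂ (last-visit (start k)))))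

      time-step : ∀ k → time k < time (suc k)
      time-step k = proj₁ (proj₂ (proj₂ (last-visit (start (suc k)))))

      seq : ℕ → V
      seq k = w (time k)

      seq-adj : ∀ k → E (seq k) (seq (suc k))
      seq-adj k with w-step (time k)
      ... | inj₁ stutter = ⊥-elim (time-final k (suc (time k)) ≤-refl stutter)
      ... | inj₂ e = subst (E (seq k)) (sym (proj₁ (proj₂ (last-visit (start (suc k)))))) e

      seq-inj : Injective _≡_ _≡_ seq
      seq-inj {i} {j} same with <-cmp i j
      ... | tri< i<j _ _ = ⊥-elim (time-final i (time j) (strictMono-step time time-step i<j) (sym same))
      ... | tri≈ _ i≡j _ = i≡j
      ... | tri> _ _ j<i = ⊥-elim (time-final j (time i) (strictMono-step time time-step j<i) same)

      ray : Ray X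
      ray = record { seq = seq ; inj = seq-inj ; adj = seq-adj }

      ≤-time : ∀ k → k ≤ time k
      ≤-time = strictMono-step⇒≥id time time-step

    exit : (P : V → Set) → ∀ {x z m} → Walk X x z m → ¬ P x → P z →
           ∃ λ y → WalkIn X (λ v → ¬ P v) x y × ∃ λ u → E y u × P u
    exit P nil ¬px pz = ⊥-elim (¬px pz)
    exit P {x} (cons {y = x′} e p) ¬px pz with em {P x′}
    ... | yes px′ = x , nil ¬px , x′ , e , px′
    ... | no ¬px′ with exit P p ¬px′ pz
    ...   | y , x′~y , u , d , pu = y , cons ¬px e x′~y , u , d , pu

    far-point : ∀ {S} → ¬ FiniteDiam X S → ∀ z M → ∃ λ x → S x × ¬ DistLe X x z M
    far-point infinite z M = dne λ ¬far → infinite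
      (M + M , diam-from-centre λ x x∈S → dne λ ¬near → ¬far (x , x∈S , ¬near))

    ¬starBall⇒bounded : ∀ {K} → ¬ IsStarBall X K →
      ∃ λ D → ∀ c → InC₀ X K c → DiamLe X (Component X K c) D
    ¬starBall⇒bounded ¬star = dne λ ¬bounded → ¬star λ D → dne λ ¬witness →
      ¬bounded (D , λ c inc → dne λ ¬diam → ¬witness (c , inc , ¬diam))

    components-meeting-bounded : (K : V → Set) (L : List V) → ∃ λ B →
      ∀ c y → InC₀ X K c → Component X K c y → y ∈ L → DiamLe X (Component X K c) B
    components-meeting-bounded K [] = 0 , λ _ _ _ _ ()
    components-meeting-bounded K (y ∷ L)
      with em {∃ λ c → InC₀ X K c × Component X K c y} | components-meeting-bounded K L
    ... | no none | B , bound = B , λ where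
      c .y inc c~y (here refl) → ⊥-elim (none (c , inc , c~y))
      c y′ inc c~y′ (there y′∈L) → bound c y′ inc c~y′ y′∈L
    ... | yes (c₀ , (_ , D , diam₀) , c₀~y) | B , bound = D + B , λ where
      c .y inc c~y (here refl) → diam-mono (m≤m+n D B) (diam-⊆ (component-⊆ c₀~y c~y) diam₀)
      c y′ inc c~y′ (there y′∈L) → diam-mono (m≤n+m B D) (bound c y′ inc c~y′ y′∈L)

    module _ (conn : Connected X) where

      component-reaches-ball : ∀ z n {c} → ¬ Ball X z n c →
        ∃ λ y → Component X (Ball X z n) c y × Ball X z (suc n) y
      component-reaches-ball z n {c} c∉K with conn c z
      ... | _ , p with exit (Ball X z n) p c∉K (dist-refl n)
      ... | y , c~y , u , e , u∈K = y , c~y , dist-step e u∈K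

      escaping-walk⇒infDiamRay : (z : V) (w : ℕ → V) →
        (∀ i → w (suc i) ≡ w i ⊎ E (w i) (w (suc i))) →
        (∀ D → ∃ λ N → ∀ i → N ≤ i → ¬ Ball X z D (w i)) → HasInfDiamRay X
      escaping-walk⇒infDiamRay z w w-step escape = ray , unbounded
        where
        finite-visits : ∀ v → ∃ λ B → ∀ i → w i ≡ v → i < B
        finite-visits v with conn v z
        ... | D , p with escape D
        ... | N , far = N , λ i w-i≡v → ≰⇒> λ N≤i →
              far i N≤i (subst (Ball X z D) (sym w-i≡v) (D , ≤-refl , p))

        open RayExtraction w w-step finite-visits

        unbounded : ¬ FiniteDiam X (RayVertices X ray)
        unbounded (D , diam) with conn (seq 0) z
        ... | D₀ , p with escape (D + D₀)
        ... | N , far = far (time N) (≤-time N)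
              (dist-trans (diam (seq N) (seq 0) (N , refl) (0 , refl)) (D₀ , ≤-refl , p))

      module DeepComponents (z : V)
        (bounded : ∀ n → ∃ λ D → ∀ c → InC₀ X (Ball X z n) c →
                                       DiamLe X (Component X (Ball X z n) c) D) where

        deep-component : ∀ n {S} → ¬ FiniteDiam X S →
          ∃ λ x → S x × ¬ FiniteDiam X (Component X (Ball X z n) x)
        deep-component n {S} infinite = x , x∈S , infinite-component
          where
          D = proj₁ (bounded n)
          far = far-point infinite z (D + suc n)
          x = proj₁ far
          x∈S = proj₁ (proj₂ far)

          x∉K : ¬ Ball X z n x
          x∉K x∈K = proj₂ (proj₂ far) (dist-mono (≤-trans (n≤1+n n) (m≤n+m (suc n) D)) x∈K)

          infinite-component : ¬ FiniteDiam X (Component X (Ball X z n) x)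
          infinite-component finite with component-reaches-ball z n x∉K
          ... | y , x~y , y∈K = proj₂ (proj₂ far)
                (dist-trans (proj₂ (bounded n) x (x∉K , finite) x y (nil x∉K) x~y) y∈K)

        module _ (infd : InfiniteDiam X) where

          deep : (n : ℕ) → Σ V λ c → ¬ FiniteDiam X (Component X (Ball X z n) c)
          deeper : (n : ℕ) → ∃ λ x → Component X (Ball X z n) (proj₁ (deep n)) x ×
                                     ¬ FiniteDiam X (Component X (Ball X z (suc n)) x)
          deep zero    = let (c , _ , infinite) = deep-component 0 infd in c , infinite
          deep (suc n) = proj₁ (deeper n) , proj₂ (proj₂ (deeper n))
          deeper n     = deep-component (suc n) (proj₂ (deep n))

          open Concatenation (λ n v → ¬ Ball X z n v) (λ n → proj₁ (deep n))
                             (λ n → proj₁ (proj₂ (deeper n)))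

          infDiamRay : HasInfDiamRay X
          infDiamRay = escaping-walk⇒infDiamRay z walk walk-step λ D →
            let (N , late) = stage-eventually D
            in N , λ i N≤i w-i∈K → walk-in-stage i (dist-mono (late i N≤i) w-i∈K)

      infinite∧¬starBall⇒infDiamRay : InfiniteDiam X → ¬ HasStarBall X → HasInfDiamRay X
      infinite∧¬starBall⇒infDiamRay infd ¬star with em {V}
      ... | no ¬v  = ⊥-elim (infd (0 , λ x → ⊥-elim (¬v x)))
      ... | yes z = DeepComponents.infDiamRay z
                      (λ n → ¬starBall⇒bounded λ star → ¬star (z , n , star)) infd

      infinite⇔infDiamRay⊎starBall : InfiniteDiam X ⇔ (HasInfDiamRay X ⊎ HasStarBall X)
      infinite⇔infDiamRay⊎starBall = mk⇔ to from
        where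
        to : InfiniteDiam X → HasInfDiamRay X ⊎ HasStarBall X
        to infd with em {HasStarBall X}
        ... | yes star = inj₂ star
        ... | no ¬star = inj₁ (infinite∧¬starBall⇒infDiamRay infd ¬star)

        from : HasInfDiamRay X ⊎ HasStarBall X → InfiniteDiam X
        from (inj₁ ray)  = infDiamRay⇒infinite ray
        from (inj₂ star) = starBall⇒infinite star

      module _ (lf : LocallyFinite X) where

        neighbours : V → List V
        neighbours y = proj₁ (lf y)

        ball-listed : ∀ z n → ∃ λ L → ∀ x → Ball X z n x → x ∈ L
        ball-listed z zero = z ∷ [] , λ { x (zero , _ , nil) → here refl }
        ball-listed z (suc n) with ball-listed z n
        ... | L , listed = z ∷ concatMap neighbours L , λ where
          x (zero , _ , nil) → here refl
          x (suc m , s≤s m≤n , cons {y = y} e p) →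
            there (∈-concatMap⁺ neighbours (lose (listed y (m , m≤n , p)) (proj₂ (lf y) x (E-sym e))))

        ray⇒infinite : HasRay X → InfiniteDiam X
        ray⇒infinite ray (D , diam) with ball-listed (Ray.seq ray 0) D
        ... | L , listed = ¬injection-into-list (Ray.seq ray) L (Ray.inj ray)
                             λ i → listed _ (diam _ _ tt tt)

        ¬starBall : ¬ HasStarBall X
        ¬starBall (z , n , star) with ball-listed z (suc n)
        ... | L , listed with components-meeting-bounded (Ball X z n) L
        ... | B , bound with star B
        ... | c , inc , unbounded with component-reaches-ball z n (proj₁ inc)
        ... | y , c~y , y∈K = unbounded (bound c y inc c~y (listed y y∈K))

        infinite⇔ray : InfiniteDiam X ⇔ HasRay X
        infinite⇔ray = mk⇔ (λ infd → proj₁ (infinite∧¬starBall⇒infDiamRay infd ¬starBall))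
                           ray⇒infinite

lemma1 : ExcludedMiddle 0ℓ → (X : Graph) → Connected X →
    (LocallyFinite X → (InfiniteDiam X ⇔ HasRay X)) ×
    (¬ LocallyFinite X → (InfiniteDiam X ⇔ (HasInfDiamRay X ⊎ HasStarBall X)))
lemma1 em X conn = infinite⇔ray X em conn , λ _ → infinite⇔infDiamRay⊎starBall X em conn
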